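{- Let $U=(U_1,\dots,U_n)$ be an ultramultideal of the Lindenbaum algebra $L_n$, and let $v^U$ be the environment assigning to each variable $X$ the unique $i$ with $[X^{id}]\in U_i$. Then for every $n$PC formula $F$ and every $i\in\{1,\dots,n\}$: $[\![F]\!]_{v^U}=i$ if and only if $[F]\in U_i$.
   Context: Fix $n\ge 2$, write $\hat n=\{1,\dots,n\}$, let $S_n$ be the group of permutations of $\hat n$ and $V$ a countable set of propositional variables. Formulas of $n$PC are: decorated variables $X^\pi$ ($X\in V$, $\pi\in S_n$); constants $\mathsf e_1,\dots,\mathsf e_n$; compound formulas $q(F,G_1,\dots,G_n)$. For $\rho\in S_n$, $F^\rho$ is defined by $(X^\pi)^\rho=X^{\rho\circ\pi}$, $(\mathsf e_k)^\rho=\mathsf e_{\rho(k)}$, $q(F,G_1,\dots,G_n)^\rho=q(F,G_1^\rho,\dots,G_n^\rho)$. $(ij)$ denotes the transposition exchanging $i$ and $j$ (identity if $i=j$). Contexts $\Gamma,\Delta$ are finite multisets of formulas, $\Gamma^\rho$ elementwise. Sequents $\Gamma\vdash_i\Delta$ ($i\in\hat n$) are provable if derivable by the rules (premises $\Rightarrow$ conclusion), for all $i,j,k\in\hat n$: (Const) $\Rightarrow\ \vdash_i\mathsf e_i$. (Id) $\Rightarrow X^\pi\vdash_i X^\rho$ whenever $\pi^{ -1}(i)=\rho^{ -1}(i)$. (Sym) $\Gamma^{(ij)}\vdash_i\Delta^{(ij)}\Rightarrow\Gamma\vdash_j\Delta$. (Neg1) if $i\ne k$: $\Gamma^{(ij)}\vdash_i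 F,\Delta^{(ij)}\Rightarrow \Gamma,F^{(jk)}\vdash_j\Delta$. (Neg2) if $j\neq k$: $\Gamma^{(ij)}\vdash_i F,\Delta^{(ij)}\Rightarrow \Gamma,F^{(ik)}\vdash_j\Delta$. (Neg3) $\{\Gamma^{(ij)},F\vdash_i\Delta^{(ij)}\}_{i\neq j}\Rightarrow\Gamma\vdash_j F,\Delta$. (qL) $\{\Gamma^{(ji)},F,G_j^{(ji)}\vdash_j\Delta^{(ji)}\}_{j\in\hat n}\Rightarrow \Gamma,q(F,G_1,\dots,G_n)\vdash_i\Delta$. (qR) $\{\Gamma^{(ji)},F\vdash_j G_j^{(ji)},\Delta^{(ji)}\}_{j\in\hat n}\Rightarrow\Gamma\vdash_i q(F,G_1,\dots,G_n),\Delta$. (Cut) $\Gamma,F\vdash_i\Delta$ and $\Gamma\vdash_i F,\Delta\Rightarrow\Gamma\vdash_i\Delta$. Left and right weakening and contraction in each $\vdash_i$. $F\sim G$ iff for all $i$, $F\vdash_i G$ and $G\vdash_i F$ are provable; $[F]$ is the $\sim$-class of $F$. The Lindenbaum algebra $L_n$ is the set of $\sim$-classes with $q([F_0],\dots,[F_n])=[q(F_0,\dots,F_n)]$ and constants $[\mathsf e_1],\dots,[\mathsf e_n]$. An ultramultideal of $L_n$ is a tuple $(U_1,\dots,U_n)$ of pairwise disjoint subsets of $L_n$ whose union is $L_n$, such that: (m1) $[\mathsf e_k]\in U_k$ for all $k$; (m2) if $a\in U_r$, $b\in U_k$ and $c_1,\dots,c_n\in L_n$, then $q(a,c_1,\dots,c_{r-1},b,c_{r+1},\dots,c_n)\in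 U_k$; (m3) if $a\in L_n$ and $c_1,\dots,c_n\in U_k$, then $q(a,c_1,\dots,c_n)\in U_k$. Semantics: an environment is $v:V\to\hat n$; $[\![X^\pi]\!]_v=\pi(v(X))$, $[\![\mathsf e_i]\!]_v=i$, $[\![q(F,G_1,\dots,G_n)]\!]_v=[\![G_k]\!]_v$ where $k=[\![F]\!]_v$. -}

module Defs where

open import Data.Nat using (ℕ)
open import Data.Fin using (Fin)
open import Data.List using (List; []; _∷_; map)
open import Data.List.Relation.Binary.Permutation.Propositional using (_↭_)
open import Data.Product using (Σ; _×_)
open import Relation.Binary.PropositionalEquality using (_≡_; _≢_)
open import Relation.Nullary using (¬_; yes; no)
open import Data.Empty using (⊥)
open import Data.Fin using (_≟_)
open import Data.Fin.Permutation using (Permutation′; _⟨$⟩ʳ_; _⟨$⟩ˡ_; _∘ₚ_; transpose)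
import Data.Fin.Permutation as P

Var : Set
Var = ℕ

data Formula (n : ℕ) : Set where
  var : Var → Permutation′ n → Formula n
  e   : Fin n → Formula n
  q   : Formula n → (Fin n → Formula n) → Formula n

module _ {n : ℕ} where

  -- transposition (ij); identity when i = j
  tr : Fin n → Fin n → Permutation′ n
  tr i j = transpose i j

  -- F^ρ.  (π ∘ₚ ρ) is "first π then ρ", i.e. the mathematical ρ ∘ π.
  _^_ : Formula n → Permutation′ n → Formula n
  var X π ^ ρ = var X (π ∘ₚ ρ)
  e k ^ ρ = e (ρ ⟨$⟩ʳ k)
  q F G ^ ρ = q F (λ k → G k ^ ρ)

  _^ᶜ_ : List (Formula n) → Permutation′ n → List (Formula n)
  Γ ^ᶜ ρ = map (λ F → F ^ ρ) Γ

  -- Contexts are finite multisets: lists together with an exchange rule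
  -- (closure under list permutation ↭).
  infix 4 _⊢[_]_
  data _⊢[_]_ : List (Formula n) → Fin n → List (Formula n) → Set where
    exch  : ∀ {Γ Γ′ Δ Δ′ i} → Γ ↭ Γ′ → Δ ↭ Δ′ → Γ ⊢[ i ] Δ → Γ′ ⊢[ i ] Δ′
    const : ∀ {i} → [] ⊢[ i ] (e i ∷ [])
    ident : ∀ {X π ρ i} → π ⟨$⟩ˡ i ≡ ρ ⟨$⟩ˡ i → (var X π ∷ []) ⊢[ i ] (var X ρ ∷ [])
    sym   : ∀ {Γ Δ i j} → (Γ ^ᶜ tr i j) ⊢[ i ] (Δ ^ᶜ tr i j) → Γ ⊢[ j ] Δ
    neg1  : ∀ {Γ Δ F i j k} → i ≢ k →
            (Γ ^ᶜ tr i j) ⊢[ i ] (F ∷ (Δ ^ᶜ tr i j)) → ((F ^ tr j k) ∷ Γ) ⊢[ j ] Δ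
    neg2  : ∀ {Γ Δ F i j k} → j ≢ k →
            (Γ ^ᶜ tr i j) ⊢[ i ] (F ∷ (Δ ^ᶜ tr i j)) → ((F ^ tr i k) ∷ Γ) ⊢[ j ] Δ
    neg3  : ∀ {Γ Δ F j} →
            ((i : Fin n) → i ≢ j → (F ∷ (Γ ^ᶜ tr i j)) ⊢[ i ] (Δ ^ᶜ tr i j)) →
            Γ ⊢[ j ] (F ∷ Δ)
    qL    : ∀ {Γ Δ F G i} →
            ((j : Fin n) → (F ∷ (G j ^ tr j i) ∷ (Γ ^ᶜ tr j i)) ⊢[ j ] (Δ ^ᶜ tr j i)) →
            (q F G ∷ Γ) ⊢[ i ] Δ
    qR    : ∀ {Γ Δ F G i} →
            ((j : Fin n) → (F ∷ (Γ ^ᶜ tr j i)) ⊢[ j ] ((G j ^ tr j i) ∷ (Δ ^ᶜ tr j i))) →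
            Γ ⊢[ i ] (q F G ∷ Δ)
    cut   : ∀ {Γ Δ F i} → (F ∷ Γ) ⊢[ i ] Δ → Γ ⊢[ i ] (F ∷ Δ) → Γ ⊢[ i ] Δ
    weakL : ∀ {Γ Δ F i} → Γ ⊢[ i ] Δ → (F ∷ Γ) ⊢[ i ] Δ
    weakR : ∀ {Γ Δ F i} → Γ ⊢[ i ] Δ → Γ ⊢[ i ] (F ∷ Δ)
    contrL : ∀ {Γ Δ F i} → (F ∷ F ∷ Γ) ⊢[ i ] Δ → (F ∷ Γ) ⊢[ i ] Δ
    contrR : ∀ {Γ Δ F i} → Γ ⊢[ i ] (F ∷ F ∷ Δ) → Γ ⊢[ i ] (F ∷ Δ)

  _∼_ : Formula n → Formula n → Set
  F ∼ G = (i : Fin n) → ((F ∷ []) ⊢[ i ] (G ∷ [])) × ((G ∷ []) ⊢[ i ] (F ∷ []))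

  _[_↦_] : (Fin n → Formula n) → Fin n → Formula n → (Fin n → Formula n)
  (c [ r ↦ b ]) s with s ≟ r
  ... | yes _ = b
  ... | no _  = c s

  -- Subsets of the Lindenbaum algebra L_n = Formula n / ∼ are represented as
  -- ∼-closed predicates on formulas; the operation q and the constants act on
  -- representatives.
  record Ultramultideal (U : Fin n → Formula n → Set) : Set where
    field
      well-defined : ∀ {k F G} → F ∼ G → U k F → U k G
      disjoint : ∀ {k l F} → k ≢ l → U k F → U l F → ⊥
      cover    : (F : Formula n) → Σ (Fin n) (λ k → U k F)
      m1 : (k : Fin n) → U k (e k)
      m2 : ∀ {r k a b} (c : Fin n → Formula n) → U r a → U k b →
           U k (q a (c [ r ↦ b ]))
      m3 : ∀ {k} (a : Formula n) (c : Fin n → Formula n) → ((s : Fin n) → U k (c s)) → U k (q a c)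

  ⟦_⟧ : Formula n → (Var → Fin n) → Fin n
  ⟦ var X π ⟧ v = π ⟨$⟩ʳ v X
  ⟦ e i ⟧ v = i
  ⟦ q F G ⟧ v = ⟦ G (⟦ F ⟧ v) ⟧ v

module Submission where

open import Defs
open import Data.Nat using (ℕ; _≤_)
open import Data.Fin using (Fin; _≟_)
open import Data.Fin.Permutation
  using (Permutation′; id; _⟨$⟩ʳ_; _⟨$⟩ˡ_; _∘ₚ_; _≈_; inverseˡ; inverseʳ)
import Data.Fin.Permutation.Components as PC
open import Data.List using ([]; _∷_)
open import Data.List.Relation.Binary.Permutation.Propositional using (↭-refl; ↭-prep; ↭-swap; ↭-trans)
open import Data.Product using (_,_)
open import Data.Empty using (⊥-elim)
open import Relation.Nullary using (yes; no)
open import Relation.Binary.PropositionalEquality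
  using (_≡_; _≢_; refl; trans; cong; subst; module ≡-Reasoning)
  renaming (sym to ≡-sym)
open import Function.Bundles using (_⇔_; mk⇔)

-- For every formula F, [F] ∈ U_⟦F⟧, by induction on F: constants are placed by (m1),
-- q(F,G) by (m2) with a = F and b = G_⟦F⟧, and a variable X^π by (m2) again after the
-- rewriting X^π ∼ q(X^id, e_π(1), …, e_π(n)).  Disjointness of the U_k gives the converse.

module _ {n : ℕ} where

  private
    Perm = Permutation′ n

  transpose-sameˡ : (i j : Fin n) → PC.transpose i j i ≡ j
  transpose-sameˡ i j with i ≟ i
  ... | yes _ = refl
  ... | no i≢i = ⊥-elim (i≢i refl)

  transpose-sameʳ : (i j : Fin n) → PC.transpose i j j ≡ i
  transpose-sameʳ i j with j ≟ i
  ... | yes j≡i = j≡i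
  ... | no _ with j ≟ j
  ...   | yes _ = refl
  ...   | no j≢j = ⊥-elim (j≢j refl)

  transpose-diagonal : (i x : Fin n) → PC.transpose i i x ≡ x
  transpose-diagonal i x with x ≟ i
  ... | yes x≡i = ≡-sym x≡i
  ... | no _ with x ≟ i
  ...   | yes x≡i = ≡-sym x≡i
  ...   | no _ = refl

  transpose-hits-first : (j i x : Fin n) → PC.transpose j i x ≡ j → x ≡ i
  transpose-hits-first j i x p = begin
    x                                  ≡⟨ ≡-sym (PC.transpose-inverse i j) ⟩
    PC.transpose i j (PC.transpose j i x) ≡⟨ cong (PC.transpose i j) p ⟩
    PC.transpose i j j                 ≡⟨ transpose-sameʳ i j ⟩
    i                                  ∎
    where open ≡-Reasoning

  ≈⇒inverse-≡ : {π ρ : Perm} → π ≈ ρ → ∀ i → π ⟨$⟩ˡ i ≡ ρ ⟨$⟩ˡ i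
  ≈⇒inverse-≡ {π} {ρ} π≈ρ i = begin
    π ⟨$⟩ˡ i                      ≡⟨ ≡-sym (inverseˡ ρ) ⟩
    ρ ⟨$⟩ˡ (ρ ⟨$⟩ʳ (π ⟨$⟩ˡ i))     ≡⟨ cong (ρ ⟨$⟩ˡ_) (≡-sym (π≈ρ _)) ⟩
    ρ ⟨$⟩ˡ (π ⟨$⟩ʳ (π ⟨$⟩ˡ i))     ≡⟨ cong (ρ ⟨$⟩ˡ_) (inverseʳ π) ⟩
    ρ ⟨$⟩ˡ i                      ∎
    where open ≡-Reasoning

  -- Without function extensionality, formulas whose permutations or argument tuples agree
  -- only pointwise are not ≡; _≋_ is syntactic equality up to such pointwise agreement.
  infix 4 _≋_
  data _≋_ : Formula n → Formula n → Set where
    var≋ : ∀ {X π ρ} → π ≈ ρ → var X π ≋ var X ρ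
    e≋   : ∀ {k l} → k ≡ l → e k ≋ e l
    q≋   : ∀ {F F′ G G′} → F ≋ F′ → (∀ s → G s ≋ G′ s) → q F G ≋ q F′ G′

  ≋-refl : ∀ {F} → F ≋ F
  ≋-refl {var X π} = var≋ λ _ → refl
  ≋-refl {e k}     = e≋ refl
  ≋-refl {q F G}   = q≋ ≋-refl λ _ → ≋-refl

  ≋-sym : ∀ {F G} → F ≋ G → G ≋ F
  ≋-sym (var≋ p) = var≋ λ x → ≡-sym (p x)
  ≋-sym (e≋ p)   = e≋ (≡-sym p)
  ≋-sym (q≋ p ps) = q≋ (≋-sym p) λ s → ≋-sym (ps s)

  ≋-trans : ∀ {F G H} → F ≋ G → G ≋ H → F ≋ H
  ≋-trans (var≋ p) (var≋ p′) = var≋ λ x → trans (p x) (p′ x)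
  ≋-trans (e≋ p) (e≋ p′)     = e≋ (trans p p′)
  ≋-trans (q≋ p ps) (q≋ p′ ps′) = q≋ (≋-trans p p′) λ s → ≋-trans (ps s) (ps′ s)

  ≡⇒≋ : ∀ {F G} → F ≡ G → F ≋ G
  ≡⇒≋ refl = ≋-refl

  ^-cong : ∀ {F F′} {ρ ρ′ : Perm} → F ≋ F′ → ρ ≈ ρ′ → F ^ ρ ≋ F′ ^ ρ′
  ^-cong {ρ = ρ} (var≋ p) ρ≈ρ′ = var≋ λ x → trans (cong (ρ ⟨$⟩ʳ_) (p x)) (ρ≈ρ′ _)
  ^-cong {ρ = ρ} (e≋ p) ρ≈ρ′   = e≋ (trans (cong (ρ ⟨$⟩ʳ_) p) (ρ≈ρ′ _))
  ^-cong (q≋ p ps) ρ≈ρ′        = q≋ p λ s → ^-cong (ps s) ρ≈ρ′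

  ^-∘ : ∀ F (ρ σ : Perm) → (F ^ ρ) ^ σ ≋ F ^ (ρ ∘ₚ σ)
  ^-∘ (var X π) ρ σ = ≋-refl
  ^-∘ (e k) ρ σ     = ≋-refl
  ^-∘ (q F G) ρ σ   = q≋ ≋-refl λ s → ^-∘ (G s) ρ σ

  ^-identity : ∀ F {ρ : Perm} → ρ ≈ id → F ^ ρ ≋ F
  ^-identity (var X π) ρ≈id = var≋ λ x → ρ≈id _
  ^-identity (e k) ρ≈id     = e≋ (ρ≈id k)
  ^-identity (q F G) ρ≈id   = q≋ ≋-refl λ s → ^-identity (G s) ρ≈id

  ≋-^-id : ∀ {H F} → H ≋ F → H ≋ F ^ id
  ≋-^-id {F = F} H≋F = ≋-trans H≋F (≋-sym (^-identity F λ _ → refl))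

  ≋-^-∘ : ∀ {H F} {ρ : Perm} (σ : Perm) → H ≋ F ^ ρ → H ^ σ ≋ F ^ (ρ ∘ₚ σ)
  ≋-^-∘ {F = F} {ρ} σ H≋Fρ = ≋-trans (^-cong H≋Fρ λ _ → refl) (^-∘ F ρ σ)

  weakL₂ : ∀ {A B : Formula n} {Δ i} → (A ∷ []) ⊢[ i ] Δ → (A ∷ B ∷ []) ⊢[ i ] Δ
  weakL₂ p = exch (↭-swap _ _ ↭-refl) ↭-refl (weakL p)

  weakL₃ : ∀ {A B C : Formula n} {Δ i} → (A ∷ B ∷ []) ⊢[ i ] Δ → (A ∷ B ∷ C ∷ []) ⊢[ i ] Δ
  weakL₃ p = exch (↭-trans (↭-swap _ _ ↭-refl) (↭-prep _ (↭-swap _ _ ↭-refl))) ↭-refl (weakL p)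

  cut-replace₂ : ∀ {G H H′ : Formula n} {i} → (H ∷ []) ⊢[ i ] (H′ ∷ []) → (G ∷ H′ ∷ []) ⊢[ i ] [] →
                 (G ∷ H ∷ []) ⊢[ i ] []
  cut-replace₂ H⊢H′ GH′⊢ = cut (exch (↭-swap _ _ ↭-refl) ↭-refl (weakL₃ GH′⊢)) (weakL H⊢H′)

  -- (Neg1) with i = j: a formula and its (m j)-transpose cannot both hold at m.
  exclusive : ∀ {A A′ : Formula n} {m j} → m ≢ j → (A′ ^ tr m m ∷ []) ⊢[ m ] (A ∷ []) →
              (A′ ∷ A ^ tr m j ∷ []) ⊢[ m ] []
  exclusive m≢j p = exch (↭-swap _ _ ↭-refl) ↭-refl (neg1 {Γ = _ ∷ []} {Δ = []} m≢j p)

  e-refute : ∀ {k j : Fin n} → k ≢ j → (e k ∷ []) ⊢[ j ] []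
  e-refute {k} {j} k≢j =
    subst (λ l → (e l ∷ []) ⊢[ j ] []) (transpose-sameˡ j k)
      (neg1 {Γ = []} {Δ = []} {i = j} (λ j≡k → k≢j (≡-sym j≡k)) const)

  e-identity : ∀ k i → (e k ∷ []) ⊢[ i ] (e k ∷ [])
  e-identity k i with k ≟ i
  ... | yes refl = weakL const
  ... | no k≢i   = weakR (e-refute k≢i)

  -- Identity F ⊢ᵢ F, generalised to permuted copies of F: (qL) and (qR) apply further
  -- transpositions to the arguments, so the induction hypothesis must absorb them.
  instances-⊢ : (F : Formula n) (ρ : Perm) {H H′ : Formula n} →
                H ≋ F ^ ρ → H′ ≋ F ^ ρ → ∀ i → (H ∷ []) ⊢[ i ] (H′ ∷ [])
  instances-⊢ (var X π) ρ {var _ π₁} {var _ π₂} (var≋ p) (var≋ p′) i =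
    ident (≈⇒inverse-≡ {π₁} {π₂} (λ x → trans (p x) (≡-sym (p′ x))) i)
  instances-⊢ (e k) ρ (e≋ p) (e≋ p′) i =
    subst (λ l → (e _ ∷ []) ⊢[ i ] (e l ∷ [])) (trans p (≡-sym p′)) (e-identity _ i)
  instances-⊢ (q A B) ρ {q A₁ B₁} {q A₂ B₂} (q≋ a₁ b₁) (q≋ a₂ b₂) i =
    qL λ j → qR λ m → branch j m
    where
    branch : ∀ j m → (A₂ ∷ A₁ ^ tr m j ∷ (B₁ j ^ tr j i) ^ tr m j ∷ []) ⊢[ m ]
                     ((B₂ m ^ tr j i) ^ tr m j ∷ [])
    branch j m with m ≟ j
    ... | yes refl = weakL (weakL (instances-⊢ (B j) ((ρ ∘ₚ tr j i) ∘ₚ tr j j)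
                       (≋-^-∘ (tr j j) (≋-^-∘ (tr j i) (b₁ j)))
                       (≋-^-∘ (tr j j) (≋-^-∘ (tr j i) (b₂ j))) j))
    ... | no m≢j   = weakR (weakL₃ (exclusive m≢j (instances-⊢ A id
                       (≋-^-id (≋-trans (^-identity A₂ {tr m m} (transpose-diagonal m)) a₂))
                       (≋-^-id a₁) m)))

  ≋⇒⊢ : ∀ {H H′} → H ≋ H′ → ∀ i → (H ∷ []) ⊢[ i ] (H′ ∷ [])
  ≋⇒⊢ H≋H′ = instances-⊢ _ id (≋-^-id H≋H′) (≋-^-id ≋-refl)

  ≋⇒∼ : ∀ {H H′} → H ≋ H′ → H ∼ H′
  ≋⇒∼ H≋H′ i = ≋⇒⊢ H≋H′ i , ≋⇒⊢ (≋-sym H≋H′) i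

  q-cong-args : ∀ {F} {G G′ : Fin n → Formula n} → (∀ s → G s ≡ G′ s) → q F G ∼ q F G′
  q-cong-args G≡G′ = ≋⇒∼ (q≋ ≋-refl λ s → ≡⇒≋ (G≡G′ s))

  update-self : ∀ (c : Fin n → Formula n) r s → (c [ r ↦ c r ]) s ≡ c s
  update-self c r s with s ≟ r
  ... | yes refl = refl
  ... | no _     = refl

  ∘-transpose-inverse : (π : Perm) (i j : Fin n) → (π ∘ₚ tr j i) ⟨$⟩ˡ j ≡ π ⟨$⟩ˡ i
  ∘-transpose-inverse π i j = cong (π ⟨$⟩ˡ_) (transpose-sameʳ i j)

  var-clash : ∀ {X} {σ : Perm} {j} → σ ⟨$⟩ˡ j ≢ j → (var X id ∷ var X σ ∷ []) ⊢[ j ] []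
  var-clash {X} {σ} {j} σ⁻¹j≢j =
    cut-replace₂ (ident (≡-sym (transpose-sameʳ (σ ⟨$⟩ˡ j) j)))
      (exclusive {A = var X id} {A′ = var X id} (λ j≡σ⁻¹j → σ⁻¹j≢j (≡-sym j≡σ⁻¹j))
        (ident (transpose-diagonal j j)))

  constants : Perm → Fin n → Formula n
  constants π s = e (π ⟨$⟩ʳ s)

  q-var-⊢-var : ∀ X (π : Perm) i → (q (var X id) (constants π) ∷ []) ⊢[ i ] (var X π ∷ [])
  q-var-⊢-var X π i = qL branch
    where
    branch : ∀ j → (var X id ∷ e (PC.transpose j i (π ⟨$⟩ʳ j)) ∷ []) ⊢[ j ] (var X (π ∘ₚ tr j i) ∷ [])
    branch j with π ⟨$⟩ʳ j ≟ i
    ... | yes πj≡i = weakL₂ (ident (≡-sym (begin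
      (π ∘ₚ tr j i) ⟨$⟩ˡ j     ≡⟨ ∘-transpose-inverse π i j ⟩
      π ⟨$⟩ˡ i                ≡⟨ cong (π ⟨$⟩ˡ_) (≡-sym πj≡i) ⟩
      π ⟨$⟩ˡ (π ⟨$⟩ʳ j)        ≡⟨ inverseˡ π ⟩
      j                       ∎)))
      where open ≡-Reasoning
    ... | no πj≢i = weakL (weakR (e-refute (λ p → πj≢i (transpose-hits-first j i _ p))))

  var-⊢-q-var : ∀ X (π : Perm) i → (var X π ∷ []) ⊢[ i ] (q (var X id) (constants π) ∷ [])
  var-⊢-q-var X π i = qR branch
    where
    branch : ∀ j → (var X id ∷ var X (π ∘ₚ tr j i) ∷ []) ⊢[ j ] (e (PC.transpose j i (π ⟨$⟩ʳ j)) ∷ [])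
    branch j with π ⟨$⟩ʳ j ≟ i
    ... | yes πj≡i = subst (λ l → (var X id ∷ var X (π ∘ₚ tr j i) ∷ []) ⊢[ j ] (e l ∷ []))
                       (≡-sym (trans (cong (PC.transpose j i) πj≡i) (transpose-sameʳ j i)))
                       (weakL (weakL const))
    ... | no πj≢i = weakR (var-clash λ p → πj≢i (begin
      π ⟨$⟩ʳ j                      ≡⟨ cong (π ⟨$⟩ʳ_) (≡-sym p) ⟩
      π ⟨$⟩ʳ ((π ∘ₚ tr j i) ⟨$⟩ˡ j)  ≡⟨ cong (π ⟨$⟩ʳ_) (∘-transpose-inverse π i j) ⟩
      π ⟨$⟩ʳ (π ⟨$⟩ˡ i)              ≡⟨ inverseʳ π ⟩
      i                             ∎))
      where open ≡-Reasoning

  q-var-∼-var : ∀ X (π : Perm) → q (var X id) (constants π) ∼ var X π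
  q-var-∼-var X π i = q-var-⊢-var X π i , var-⊢-q-var X π i

module _ {n : ℕ} {U : Fin n → Formula n → Set} (UM : Ultramultideal U) where
  open Ultramultideal UM

  q-∈-selected : ∀ {r k a} (c : Fin n → Formula n) → U r a → U k (c r) → U k (q a c)
  q-∈-selected c a∈Uᵣ cᵣ∈Uₖ = well-defined (q-cong-args (update-self c _)) (m2 c a∈Uᵣ cᵣ∈Uₖ)

  ∈-unique : ∀ {k l F} → U k F → U l F → k ≡ l
  ∈-unique {k} {l} F∈Uₖ F∈Uₗ with k ≟ l
  ... | yes k≡l = k≡l
  ... | no k≢l  = ⊥-elim (disjoint k≢l F∈Uₖ F∈Uₗ)

  ∈-value : (v : Var → Fin n) → (∀ X → U (v X) (var X id)) → ∀ F → U (⟦ F ⟧ v) F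
  ∈-value v X∈ (var X π) = well-defined (q-var-∼-var X π) (q-∈-selected (constants π) (X∈ X) (m1 _))
  ∈-value v X∈ (e k)     = m1 k
  ∈-value v X∈ (q F G)   = q-∈-selected G (∈-value v X∈ F) (∈-value v X∈ (G (⟦ F ⟧ v)))

lemma4p9 : (n : ℕ) → 2 ≤ n → (U : Fin n → Formula n → Set) → Ultramultideal U →
    (vU : Var → Fin n) → ((X : Var) → U (vU X) (var X id)) →
    (F : Formula n) (i : Fin n) → (⟦ F ⟧ vU ≡ i) ⇔ U i F
-- The argument does not need n ≥ 2.
lemma4p9 n _ U UM vU X∈ F i = mk⇔ value⇒∈ (∈-unique UM (∈-value UM vU X∈ F))
  where
  value⇒∈ : ⟦ F ⟧ vU ≡ i → U i F
  value⇒∈ refl = ∈-value UM vU X∈ F
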